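{- Let $P\in\{0,1\}^{n\times n}$ be nonsingular such that the simplex $\mathrm{conv}\{0,\text{columns of }P\}$ is nonobtuse. Then for all $v\in\{0,1\}^n$, \[ v^\top (P^\top P)^{ -1}\,\overline{v}\le 0. \] If the simplex is even acute, then $v^\top (P^\top P)^{ -1}\,\overline{v}<0$ for all $v\in\{0,1\}^n\setminus\{0,e^n\}$.
   Context: $e^n$ denotes the all-ones vector in $\mathbb{R}^n$ and $\overline{v}=e^n-v$ is the antipode of $v\in\{0,1\}^n$. A simplex is nonobtuse (resp. acute) if each dihedral angle ($\pi$ minus the angle between inward normals of two facets) is at most (resp. less than) $\pi/2$. -}

module Defs where

open import Data.Nat using (ℕ; zero; suc)
open import Data.Fin using (Fin; zero; suc)
open import Data.Bool using (Bool; true; false; not)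
open import Data.Rational using (ℚ; 0ℚ; 1ℚ; _+_; _*_; _-_; _≤_; _<_)
open import Relation.Binary.PropositionalEquality using (_≡_; _≢_)

Vecℚ : ℕ → Set
Vecℚ n = Fin n → ℚ

Mat : ℕ → Set
Mat n = Fin n → Fin n → ℚ

Σ : ∀ {n} → (Fin n → ℚ) → ℚ
Σ {zero}  f = 0ℚ
Σ {suc n} f = f zero + Σ (λ i → f (suc i))

_·_ : ∀ {n} → Vecℚ n → Vecℚ n → ℚ
u · w = Σ (λ i → u i * w i)

_−ᵥ_ : ∀ {n} → Vecℚ n → Vecℚ n → Vecℚ n
(u −ᵥ w) i = u i - w i

zeroV : ∀ {n} → Vecℚ n
zeroV _ = 0ℚ

b2q : Bool → ℚ
b2q true  = 1ℚ
b2q false = 0ℚ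

_⊗_ : ∀ {n} → Mat n → Mat n → Mat n
(A ⊗ B) i j = Σ (λ k → A i k * B k j)

_ᵀ : ∀ {n} → Mat n → Mat n
(A ᵀ) i j = A j i

Id : ∀ {n} → Mat n
Id {suc n} zero    zero    = 1ℚ
Id {suc n} zero    (suc j) = 0ℚ
Id {suc n} (suc i) zero    = 0ℚ
Id {suc n} (suc i) (suc j) = Id {n} i j

toℚ : ∀ {n} → (Fin n → Fin n → Bool) → Mat n
toℚ P i j = b2q (P i j)

IsInverse : ∀ {n} → Mat n → Mat n → Set
IsInverse M A = ((M ⊗ A) ≡ Id) Data.Product.× ((A ⊗ M) ≡ Id)
  where import Data.Product

Nonsingular : ∀ {n} → Mat n → Set
Nonsingular {n} A = Data.Product.Σ (Mat n) (λ M → IsInverse M A)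
  where import Data.Product

Simplex : ℕ → Set
Simplex n = Fin (suc n) → Vecℚ n

simplexOf : ∀ {n} → Mat n → Simplex n
simplexOf P zero    = zeroV
simplexOf P (suc j) i = P i j

-- w is an inward normal of the facet of S opposite vertex k:
-- w is orthogonal to the facet (to all differences of its vertices)
-- and points towards the opposite vertex k.
InwardNormal : ∀ {n} → Simplex n → Fin (suc n) → Vecℚ n → Set
InwardNormal S k w =
  (∀ j l → j ≢ k → l ≢ k → w · (S j −ᵥ S l) ≡ 0ℚ)
  Data.Product.× (∀ l → l ≢ k → 0ℚ < w · (S k −ᵥ S l))
  where import Data.Product

-- The dihedral angle between facets k and m equals π minus the angle between
-- their inward normals; it is ≤ π/2 (resp. < π/2) iff the inner product of
-- the inward normals is ≤ 0 (resp. < 0).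
Nonobtuse : ∀ {n} → Simplex n → Set
Nonobtuse S = ∀ k m → k ≢ m → ∀ u w →
  InwardNormal S k u → InwardNormal S m w → (u · w) ≤ 0ℚ

Acute : ∀ {n} → Simplex n → Set
Acute S = ∀ k m → k ≢ m → ∀ u w →
  InwardNormal S k u → InwardNormal S m w → (u · w) < 0ℚ

form : ∀ {n} → Vecℚ n → Mat n → Vecℚ n → ℚ
form v G w = Σ (λ i → v i * Σ (λ j → G i j * w j))

vec01 : ∀ {n} → (Fin n → Bool) → Vecℚ n
vec01 v i = b2q (v i)

antipode : ∀ {n} → (Fin n → Bool) → Vecℚ n
antipode v i = 1ℚ - b2q (v i)

module Submission where

-- Let M be the inverse of A = P (as a rational matrix).  Then
--   (1) G = (AᵀA)⁻¹ equals M Mᵀ, i.e. G i j is the inner product of rows i, j of M;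
--   (2) since M A = I, row i of M is orthogonal to every vertex of the simplex
--       conv{0, columns of A} except column i, where it takes the value 1; so it is
--       an inward normal of the facet opposite that vertex;
--   (3) hence nonobtuseness (acuteness) makes every off-diagonal entry of G
--       nonpositive (negative);
--   (4) vᵀ G (e − v) = Σ_{i,j} v_i G_ij (1 − v_j) only involves entries with v_i = 1
--       and v_j = 0, which are off-diagonal; so it is ≤ 0, and < 0 as soon as such a
--       pair (i, j) exists, i.e. when v ∉ {0, e}.

open import Defs
open import Data.Nat using (ℕ; zero; suc)
open import Data.Fin using (Fin; zero; suc)
open import Data.Fin.Properties using (suc-injective; ¬∀⟶∃¬)
open import Data.Bool using (Bool; true; false; _≟_)
open import Data.Bool.Properties using (¬-not)
open import Data.Product using (_×_; _,_; ∃)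
open import Data.Rational using (ℚ; 0ℚ; 1ℚ; _≤_; _<_; _+_; _*_; _-_; -_)
open import Data.Rational.Properties
  using ( +-identityˡ; +-identityʳ; *-identityˡ; *-identityʳ; *-zeroˡ; *-zeroʳ
        ; *-comm; *-assoc; *-distribˡ-+; neg-distrib-+; neg-distribʳ-*
        ; ≤-refl; ≤-reflexive; <⇒≤; +-mono-≤; +-mono-<-≤; +-mono-≤-<; positive⁻¹
        ; +-0-commutativeMonoid )
open import Data.Empty using (⊥-elim)
open import Relation.Binary.PropositionalEquality
open import Relation.Nullary using (¬_)
open import Level using (0ℓ)
open import Relation.Binary.Bundles using (Setoid)
import Relation.Binary.Reasoning.Setoid as SetoidReasoning
open import Algebra.Bundles using (CommutativeMonoid)
open import Algebra.Properties.CommutativeSemigroup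
  (CommutativeMonoid.commutativeSemigroup +-0-commutativeMonoid) using (interchange)

Σ-cong : ∀ {n} {f g : Fin n → ℚ} → (∀ i → f i ≡ g i) → Σ f ≡ Σ g
Σ-cong {zero}  h = refl
Σ-cong {suc n} h = cong₂ _+_ (h zero) (Σ-cong (λ i → h (suc i)))

Σ-zero : ∀ {n} → Σ {n} (λ _ → 0ℚ) ≡ 0ℚ
Σ-zero {zero}  = refl
Σ-zero {suc n} = cong (0ℚ +_) (Σ-zero {n})

Σ-+ : ∀ {n} (f g : Fin n → ℚ) → Σ (λ i → f i + g i) ≡ Σ f + Σ g
Σ-+ {zero}  f g = refl
Σ-+ {suc n} f g =
  trans (cong (f zero + g zero +_) (Σ-+ (λ i → f (suc i)) (λ i → g (suc i))))
        (interchange (f zero) (g zero) _ _)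

Σ-neg : ∀ {n} (f : Fin n → ℚ) → Σ (λ i → - f i) ≡ - Σ f
Σ-neg {zero}  f = refl
Σ-neg {suc n} f = trans (cong (- f zero +_) (Σ-neg (λ i → f (suc i))))
                        (sym (neg-distrib-+ (f zero) _))

Σ-*ˡ : ∀ {n} (c : ℚ) (f : Fin n → ℚ) → Σ (λ i → c * f i) ≡ c * Σ f
Σ-*ˡ {zero}  c f = sym (*-zeroʳ c)
Σ-*ˡ {suc n} c f = trans (cong (c * f zero +_) (Σ-*ˡ c (λ i → f (suc i))))
                         (sym (*-distribˡ-+ c (f zero) _))

Σ-*ʳ : ∀ {n} (c : ℚ) (f : Fin n → ℚ) → Σ (λ i → f i * c) ≡ Σ f * c
Σ-*ʳ c f = trans (Σ-cong (λ i → *-comm (f i) c)) (trans (Σ-*ˡ c f) (*-comm c _))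

Σ-swap : ∀ {m n} (f : Fin m → Fin n → ℚ) →
  Σ (λ i → Σ (λ j → f i j)) ≡ Σ (λ j → Σ (λ i → f i j))
Σ-swap {zero}  {n} f = sym (Σ-zero {n})
Σ-swap {suc m}     f = trans (cong (Σ (f zero) +_) (Σ-swap (λ i → f (suc i))))
                             (sym (Σ-+ (f zero) _))

Σ-nonpos : ∀ {n} (f : Fin n → ℚ) → (∀ i → f i ≤ 0ℚ) → Σ f ≤ 0ℚ
Σ-nonpos {zero}  f h = ≤-refl
Σ-nonpos {suc n} f h = +-mono-≤ (h zero) (Σ-nonpos (λ i → f (suc i)) (λ i → h (suc i)))

Σ-neg-strict : ∀ {n} (f : Fin n → ℚ) → (∀ i → f i ≤ 0ℚ) → (k : Fin n) → f k < 0ℚ →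
  Σ f < 0ℚ
Σ-neg-strict {suc n} f h zero    fk<0 =
  +-mono-<-≤ fk<0 (Σ-nonpos (λ i → f (suc i)) (λ i → h (suc i)))
Σ-neg-strict {suc n} f h (suc k) fk<0 =
  +-mono-≤-< (h zero) (Σ-neg-strict (λ i → f (suc i)) (λ i → h (suc i)) k fk<0)

·-−ᵥ : ∀ {n} (w u v : Vecℚ n) → w · (u −ᵥ v) ≡ (w · u) - (w · v)
·-−ᵥ w u v = begin
  Σ (λ i → w i * (u i + - v i))
    ≡⟨ Σ-cong (λ i → trans (*-distribˡ-+ (w i) (u i) _)
                           (cong (w i * u i +_) (sym (neg-distribʳ-* (w i) (v i))))) ⟩
  Σ (λ i → w i * u i + - (w i * v i))
    ≡⟨ Σ-+ (λ i → w i * u i) (λ i → - (w i * v i)) ⟩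
  (w · u) + Σ (λ i → - (w i * v i))
    ≡⟨ cong ((w · u) +_) (Σ-neg (λ i → w i * v i)) ⟩
  (w · u) - (w · v) ∎
  where open ≡-Reasoning

infix 4 _≈_
_≈_ : ∀ {n} → Mat n → Mat n → Set
A ≈ B = ∀ i j → A i j ≡ B i j

≈-setoid : ℕ → Setoid 0ℓ 0ℓ
≈-setoid n = record
  { Carrier       = Mat n
  ; _≈_           = _≈_
  ; isEquivalence = record
    { refl  = λ i j → refl
    ; sym   = λ p i j → sym (p i j)
    ; trans = λ p q i j → trans (p i j) (q i j)
    }
  }

module MatReasoning {n : ℕ} = SetoidReasoning (≈-setoid n)

≡⇒≈ : ∀ {n} {A B : Mat n} → A ≡ B → A ≈ B
≡⇒≈ refl i j = refl

⊗-congˡ : ∀ {n} {A B : Mat n} (C : Mat n) → A ≈ B → (A ⊗ C) ≈ (B ⊗ C)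
⊗-congˡ C p i j = Σ-cong (λ k → cong (_* C k j) (p i k))

⊗-congʳ : ∀ {n} (A : Mat n) {B C : Mat n} → B ≈ C → (A ⊗ B) ≈ (A ⊗ C)
⊗-congʳ A p i j = Σ-cong (λ k → cong (A i k *_) (p k j))

⊗-assoc : ∀ {n} (A B C : Mat n) → ((A ⊗ B) ⊗ C) ≈ (A ⊗ (B ⊗ C))
⊗-assoc A B C i j = begin
  Σ (λ k → Σ (λ l → A i l * B l k) * C k j)
    ≡⟨ Σ-cong (λ k → sym (Σ-*ʳ (C k j) (λ l → A i l * B l k))) ⟩
  Σ (λ k → Σ (λ l → A i l * B l k * C k j))
    ≡⟨ Σ-swap (λ k l → A i l * B l k * C k j) ⟩
  Σ (λ l → Σ (λ k → A i l * B l k * C k j))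
    ≡⟨ Σ-cong (λ l → trans (Σ-cong (λ k → *-assoc (A i l) (B l k) (C k j)))
                           (Σ-*ˡ (A i l) (λ k → B l k * C k j))) ⟩
  Σ (λ l → A i l * Σ (λ k → B l k * C k j)) ∎
  where open ≡-Reasoning

⊗-ᵀ : ∀ {n} (A B : Mat n) → ((A ⊗ B) ᵀ) ≈ ((B ᵀ) ⊗ (A ᵀ))
⊗-ᵀ A B i j = Σ-cong (λ k → *-comm (A j k) (B k i))

Id-diag : ∀ {n} (i : Fin n) → Id i i ≡ 1ℚ
Id-diag zero    = refl
Id-diag (suc i) = Id-diag i

Id-off : ∀ {n} (i j : Fin n) → i ≢ j → Id i j ≡ 0ℚ
Id-off zero    zero    i≢j = ⊥-elim (i≢j refl)
Id-off zero    (suc j) i≢j = refl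
Id-off (suc i) zero    i≢j = refl
Id-off (suc i) (suc j) i≢j = Id-off i j (λ i≡j → i≢j (cong suc i≡j))

Id-ᵀ : ∀ {n} → ((Id {n}) ᵀ) ≈ Id
Id-ᵀ zero    zero    = refl
Id-ᵀ zero    (suc j) = refl
Id-ᵀ (suc i) zero    = refl
Id-ᵀ (suc i) (suc j) = Id-ᵀ i j

Σ-Idˡ : ∀ {n} (x : Vecℚ n) (i : Fin n) → Σ (λ k → Id i k * x k) ≡ x i
Σ-Idˡ {suc n} x zero =
  trans (cong₂ _+_ (*-identityˡ (x zero))
                   (trans (Σ-cong (λ k → *-zeroˡ (x (suc k)))) (Σ-zero {n})))
        (+-identityʳ _)
Σ-Idˡ {suc n} x (suc i) =
  trans (cong₂ _+_ (*-zeroˡ (x zero)) (Σ-Idˡ (λ k → x (suc k)) i)) (+-identityˡ _)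

Σ-Idʳ : ∀ {n} (x : Vecℚ n) (j : Fin n) → Σ (λ k → x k * Id k j) ≡ x j
Σ-Idʳ x j = trans (Σ-cong (λ k → trans (*-comm (x k) (Id k j)) (cong (_* x k) (Id-ᵀ j k))))
                  (Σ-Idˡ x j)

⊗-identityˡ : ∀ {n} (A : Mat n) → (Id ⊗ A) ≈ A
⊗-identityˡ A i j = Σ-Idˡ (λ k → A k j) i

⊗-identityʳ : ∀ {n} (A : Mat n) → (A ⊗ Id) ≈ A
⊗-identityʳ A i j = Σ-Idʳ (A i) j

inverse-unique : ∀ {n} {G B H : Mat n} → (G ⊗ B) ≈ Id → (B ⊗ H) ≈ Id → G ≈ H
inverse-unique {G = G} {B} {H} GB BH = begin
  G              ≈˘⟨ ⊗-identityʳ G ⟩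
  G ⊗ Id         ≈˘⟨ ⊗-congʳ G BH ⟩
  G ⊗ (B ⊗ H)    ≈˘⟨ ⊗-assoc G B H ⟩
  (G ⊗ B) ⊗ H    ≈⟨ ⊗-congˡ H GB ⟩
  Id ⊗ H         ≈⟨ ⊗-identityˡ H ⟩
  H              ∎
  where open MatReasoning

gram-right-inverse : ∀ {n} (A M : Mat n) → (M ⊗ A) ≈ Id → (A ⊗ M) ≈ Id →
  (((A ᵀ) ⊗ A) ⊗ (M ⊗ (M ᵀ))) ≈ Id
gram-right-inverse A M MA AM = begin
  ((A ᵀ) ⊗ A) ⊗ (M ⊗ (M ᵀ))    ≈⟨ ⊗-assoc (A ᵀ) A (M ⊗ (M ᵀ)) ⟩
  (A ᵀ) ⊗ (A ⊗ (M ⊗ (M ᵀ)))    ≈˘⟨ ⊗-congʳ (A ᵀ) (⊗-assoc A M (M ᵀ)) ⟩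
  (A ᵀ) ⊗ ((A ⊗ M) ⊗ (M ᵀ))    ≈⟨ ⊗-congʳ (A ᵀ) (⊗-congˡ (M ᵀ) AM) ⟩
  (A ᵀ) ⊗ (Id ⊗ (M ᵀ))         ≈⟨ ⊗-congʳ (A ᵀ) (⊗-identityˡ (M ᵀ)) ⟩
  (A ᵀ) ⊗ (M ᵀ)                ≈˘⟨ ⊗-ᵀ M A ⟩
  (M ⊗ A) ᵀ                    ≈⟨ (λ i j → MA j i) ⟩
  Id ᵀ                         ≈⟨ Id-ᵀ ⟩
  Id                           ∎
  where open MatReasoning

module _ {n} (A M : Mat n) (MA : (M ⊗ A) ≈ Id) (i : Fin n) where

  row-vanishes : ∀ k → k ≢ suc i → M i · simplexOf A k ≡ 0ℚ
  row-vanishes zero    _   = trans (Σ-cong (λ l → *-zeroʳ (M i l))) (Σ-zero {n})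
  row-vanishes (suc j) j≢i = trans (MA i j) (Id-off i j (λ i≡j → j≢i (cong suc (sym i≡j))))

  row-at-own-vertex : M i · simplexOf A (suc i) ≡ 1ℚ
  row-at-own-vertex = trans (MA i i) (Id-diag i)

  inverse-row-inward : InwardNormal (simplexOf A) (suc i) (M i)
  inverse-row-inward = orthogonal , inward
    where
    S : Simplex n
    S = simplexOf A
    orthogonal : ∀ k l → k ≢ suc i → l ≢ suc i → M i · (S k −ᵥ S l) ≡ 0ℚ
    orthogonal k l k≢i l≢i =
      trans (·-−ᵥ (M i) (S k) (S l)) (cong₂ _-_ (row-vanishes k k≢i) (row-vanishes l l≢i))
    inward : ∀ l → l ≢ suc i → 0ℚ < M i · (S (suc i) −ᵥ S l)
    inward l l≢i = subst (0ℚ <_)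
      (sym (trans (·-−ᵥ (M i) (S (suc i)) (S l))
                  (cong₂ _-_ row-at-own-vertex (row-vanishes l l≢i))))
      (positive⁻¹ 1ℚ)

OffDiagonal : ∀ {n} → (ℚ → ℚ → Set) → Mat n → Set
OffDiagonal _R_ G = ∀ i j → i ≢ j → G i j R 0ℚ

-- Entry (i, j) of M Mᵀ is the inner product of the normals to facets i+1 and j+1,
-- so its sign is controlled by the corresponding dihedral angle.
nonobtuse⇒offdiag-nonpos : ∀ {n} (A M : Mat n) → (M ⊗ A) ≈ Id →
  Nonobtuse (simplexOf A) → OffDiagonal _≤_ (M ⊗ (M ᵀ))
nonobtuse⇒offdiag-nonpos A M MA nonobtuse i j i≢j =
  nonobtuse (suc i) (suc j) (λ e → i≢j (suc-injective e)) (M i) (M j)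
            (inverse-row-inward A M MA i) (inverse-row-inward A M MA j)

acute⇒offdiag-neg : ∀ {n} (A M : Mat n) → (M ⊗ A) ≈ Id →
  Acute (simplexOf A) → OffDiagonal _<_ (M ⊗ (M ᵀ))
acute⇒offdiag-neg A M MA acute i j i≢j =
  acute (suc i) (suc j) (λ e → i≢j (suc-injective e)) (M i) (M j)
        (inverse-row-inward A M MA i) (inverse-row-inward A M MA j)

OffDiagonal-resp : ∀ {n} (_R_ : ℚ → ℚ → Set) {G H : Mat n} → G ≈ H →
  OffDiagonal _R_ H → OffDiagonal _R_ G
OffDiagonal-resp _R_ G≈H h i j i≢j = subst (_R 0ℚ) (sym (G≈H i j)) (h i j i≢j)

offdiag-weaken : ∀ {n} {G : Mat n} → OffDiagonal _<_ G → OffDiagonal _≤_ G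
offdiag-weaken offdiag i j i≢j = <⇒≤ (offdiag i j i≢j)

module _ {n} (G : Mat n) (v : Fin n → Bool) where

  distinct : ∀ {i j} → v i ≡ true → v j ≡ false → i ≢ j
  distinct vi vj refl with trans (sym vi) vj
  ... | ()

  row-term : Fin n → ℚ
  row-term i = vec01 v i * Σ (λ j → G i j * antipode v j)

  -- For v i = true only the columns j with v j = false contribute, with weight G i j.
  column-term-nonpos : OffDiagonal _≤_ G → ∀ i → v i ≡ true → ∀ j →
    G i j * antipode v j ≤ 0ℚ
  column-term-nonpos offdiag i vi j with v j in vj
  ... | true  = ≤-reflexive (*-zeroʳ (G i j))
  ... | false = subst (_≤ 0ℚ) (sym (*-identityʳ (G i j))) (offdiag i j (distinct vi vj))

  column-term-neg : OffDiagonal _<_ G → ∀ i j → v i ≡ true → v j ≡ false →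
    G i j * antipode v j < 0ℚ
  column-term-neg offdiag i j vi vj rewrite vj =
    subst (_< 0ℚ) (sym (*-identityʳ (G i j))) (offdiag i j (distinct vi vj))

  row-term-nonpos : OffDiagonal _≤_ G → ∀ i → row-term i ≤ 0ℚ
  row-term-nonpos offdiag i with v i in vi
  ... | false = ≤-reflexive (*-zeroˡ (Σ (λ j → G i j * antipode v j)))
  ... | true  = subst (_≤ 0ℚ) (sym (*-identityˡ _))
                      (Σ-nonpos _ (column-term-nonpos offdiag i vi))

  row-term-neg : OffDiagonal _<_ G → ∀ i j → v i ≡ true → v j ≡ false → row-term i < 0ℚ
  row-term-neg offdiag i j vi vj rewrite vi =
    subst (_< 0ℚ) (sym (*-identityˡ _))
          (Σ-neg-strict _ (column-term-nonpos (offdiag-weaken offdiag) i vi) j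
                        (column-term-neg offdiag i j vi vj))

  form-antipode-nonpos : OffDiagonal _≤_ G → form (vec01 v) G (antipode v) ≤ 0ℚ
  form-antipode-nonpos offdiag = Σ-nonpos row-term (row-term-nonpos offdiag)

  form-antipode-neg : OffDiagonal _<_ G → ∀ i j → v i ≡ true → v j ≡ false →
    form (vec01 v) G (antipode v) < 0ℚ
  form-antipode-neg offdiag i j vi vj =
    Σ-neg-strict row-term (row-term-nonpos (offdiag-weaken offdiag)) i
                 (row-term-neg offdiag i j vi vj)

mixed-coordinates : ∀ {n} (v : Fin n → Bool) →
  ¬ (∀ i → v i ≡ false) → ¬ (∀ i → v i ≡ true) →
  ∃ (λ i → v i ≡ true) × ∃ (λ j → v j ≡ false)
mixed-coordinates {n} v not-zero not-one
  with ¬∀⟶∃¬ n (λ i → v i ≡ false) (λ i → v i ≟ false) not-zero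
     | ¬∀⟶∃¬ n (λ i → v i ≡ true)  (λ i → v i ≟ true)  not-one
... | i , vi≢false | j , vj≢true = (i , ¬-not vi≢false) , (j , ¬-not vj≢true)

lemma2p9 : (n : ℕ) (P : Fin n → Fin n → Bool) →
    Nonsingular (toℚ P) →
    (G : Mat n) → IsInverse G ((toℚ P ᵀ) ⊗ toℚ P) →
    (Nonobtuse (simplexOf (toℚ P)) →
      (v : Fin n → Bool) → form (vec01 v) G (antipode v) ≤ 0ℚ)
    ×
    (Acute (simplexOf (toℚ P)) →
      (v : Fin n → Bool) → ¬ (∀ i → v i ≡ false) → ¬ (∀ i → v i ≡ true) →
      form (vec01 v) G (antipode v) < 0ℚ)
lemma2p9 n P (M , MA , AM) G (GB , _) = nonobtuse-case , acute-case
  where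
  A : Mat n
  A = toℚ P
  G≈MMᵀ : G ≈ (M ⊗ (M ᵀ))
  G≈MMᵀ = inverse-unique (≡⇒≈ GB) (gram-right-inverse A M (≡⇒≈ MA) (≡⇒≈ AM))

  nonobtuse-case : Nonobtuse (simplexOf A) →
    (v : Fin n → Bool) → form (vec01 v) G (antipode v) ≤ 0ℚ
  nonobtuse-case nonobtuse v = form-antipode-nonpos G v
    (OffDiagonal-resp _≤_ G≈MMᵀ (nonobtuse⇒offdiag-nonpos A M (≡⇒≈ MA) nonobtuse))

  acute-case : Acute (simplexOf A) →
    (v : Fin n → Bool) → ¬ (∀ i → v i ≡ false) → ¬ (∀ i → v i ≡ true) →
    form (vec01 v) G (antipode v) < 0ℚ
  acute-case acute v not-zero not-one
    with mixed-coordinates v not-zero not-one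
  ... | (i , vi) , (j , vj) = form-antipode-neg G v
    (OffDiagonal-resp _<_ G≈MMᵀ (acute⇒offdiag-neg A M (≡⇒≈ MA) acute)) i j vi vj
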